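{- Let $n$ be a positive integer, $k=\lceil\log_3 n\rceil$, and let $m$ be an integer with $n\le m<3^k<3n$. Suppose that $m=\delta p^{r}$, where $\delta\ge 4$ is an integer, $p\ge 5$ is a prime, $r\ge 2$ is an integer and $p\nmid\delta$. Then there exist integers $1\le a<b\le n$ such that $b^3+b\equiv a^3+a\pmod{m}$.
   Context: $\lceil x\rceil$ denotes the smallest integer no less than $x$. -}

module Defs where

open import Data.Nat using (ℕ; zero; suc; _≤_; _<_; _^_)
open import Data.Integer as ℤ using (ℤ; +_)
open import Data.Integer.Divisibility as ℤd using ()

IsCeilLog3 : ℕ → ℕ → Set
IsCeilLog3 n k = n ≤ 3 ^ k × (∀ j → n ≤ 3 ^ j → k ≤ j)
  where open import Data.Product using (_×_)

_≡_[mod_] : ℕ → ℕ → ℕ → Set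
x ≡ y [mod m ] = (+ m) ℤd.∣ ((+ x) ℤ.- (+ y))

{-# OPTIONS --safe #-}
module Submission where

-- Put b = a + d. Then b³ + b = a³ + a + d · Φ a d with Φ a d = 3a² + 3ad + d² + 1, and
-- 4 Φ a d = 3 (2a + d)² + d² + 4.  Take d = δ t with 1 ≤ t ≤ p.  If p^r ∣ Φ a d for some
-- 1 ≤ a ≤ p^r, then m = δ p^r divides b³ + b − (a³ + a), and b ≤ p^r + δ p ≤ m / 3 < n as soon
-- as 3 (δ + p^(r-1)) ≤ δ p^(r-1).  A root of Φ (·, d) modulo p at which ∂Φ/∂a = 3 (2a + d) is
-- a unit comes from the pigeonhole principle applied to the residues of 3u² and
-- −((δ (2v + 1))² + 4) for 0 ≤ u, v ≤ (p − 1)/2; Hensel's lemma lifts it to a root modulo p^r.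
-- The remaining cases have r = 2, δ < 8 and p < 12, and are settled by explicit witnesses.

open import Defs
open import Data.Nat
  using (ℕ; zero; suc; _+_; _*_; _^_; _∸_; _≤_; _<_; z≤n; s≤s; s≤s⁻¹; NonZero; >-nonZero; _%_; _/_; _≤?_; _<?_)
open import Data.Nat.Properties
open import Data.Nat.DivMod using (m≡m%n+[m/n]*n; m%n<n)
open import Data.Nat.Divisibility
open import Data.Nat.Primality using (Prime; prime?; euclidsLemma; prime⇒irreducible; prime⇒nonZero)
open import Data.Nat.Coprimality using (Coprime; coprime-Bézout; coprime-divisor)
open import Data.Nat.GCD using (module Bézout)
open import Data.Nat.Tactic.RingSolver using (solve-∀)
open import Data.Integer as ℤ using ()
open import Data.Integer.Properties using (m-n≡m⊖n; ⊖-≥)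
open import Data.Fin as Fin using (Fin; toℕ; fromℕ<; splitAt; join)
open import Data.Fin.Properties using (pigeonhole; toℕ-fromℕ<; toℕ≤pred[n]; toℕ-injective; join-splitAt)
open import Data.Product using (_×_; _,_; proj₁; proj₂; ∃; ∃₂; ∃-syntax)
open import Data.Sum using (_⊎_; inj₁; inj₂; [_,_]′)
open import Function using (_∘_)
open import Relation.Binary.PropositionalEquality
open import Relation.Binary.Definitions using (tri<; tri≈; tri>)
open import Relation.Nullary using (¬_; Dec; yes; no; ¬?; contradiction)
open import Relation.Nullary.Decidable using (_×-dec_; _→-dec_; toWitness)

Φ : ℕ → ℕ → ℕ
Φ a d = 3 * a * a + 3 * a * d + d * d + 1

∂Φ : ℕ → ℕ → ℕ
∂Φ a d = 3 * (2 * a + d)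

x³+x-shift : ∀ a d → (a + d) ^ 3 + (a + d) ≡ a ^ 3 + a + d * Φ a d
x³+x-shift = identity
  where
  identity : ∀ a d → (a + d) * ((a + d) * ((a + d) * 1)) + (a + d)
                   ≡ a * (a * (a * 1)) + a + d * (3 * a * a + 3 * a * d + d * d + 1)
  identity = solve-∀

Φ-shift : ∀ a d M c → Φ (a + M * c) d ≡ Φ a d + M * (c * (∂Φ a d + 3 * M * c))
Φ-shift = identity
  where
  identity : ∀ a d M c → 3 * (a + M * c) * (a + M * c) + 3 * (a + M * c) * d + d * d + 1
                       ≡ 3 * a * a + 3 * a * d + d * d + 1 + M * (c * (3 * (2 * a + d) + 3 * M * c))
  identity = solve-∀

∂Φ-shift : ∀ a d M c → ∂Φ (a + M * c) d ≡ ∂Φ a d + M * (6 * c)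
∂Φ-shift = identity
  where
  identity : ∀ a d M c → 3 * (2 * (a + M * c) + d) ≡ 3 * (2 * a + d) + M * (6 * c)
  identity = solve-∀

∣m+n∣n⇒∣m : ∀ {d m n} → d ∣ m + n → d ∣ n → d ∣ m
∣m+n∣n⇒∣m {d} {m} {n} d∣m+n = ∣m+n∣m⇒∣n (subst (d ∣_) (+-comm m n) d∣m+n)

∣m+d*n⇒∣m : ∀ {d m} n → d ∣ m + d * n → d ∣ m
∣m+d*n⇒∣m n d∣m+dn = ∣m+n∣n⇒∣m d∣m+dn (m∣m*n n)

∣m⇒∣m+d*n : ∀ {d m} n → d ∣ m → d ∣ m + d * n
∣m⇒∣m+d*n n d∣m = ∣m∣n⇒∣m+n d∣m (m∣m*n n)

0<n<p⇒∤ : ∀ {p n} → 0 < n → n < p → p ∤ n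
0<n<p⇒∤ 0<n = >⇒∤ {{>-nonZero 0<n}}

∤∧∤⇒∤* : ∀ {p m n} → Prime p → p ∤ m → p ∤ n → p ∤ m * n
∤∧∤⇒∤* p-prime p∤m p∤n p∣mn = [ p∤m , p∤n ]′ (euclidsLemma _ _ p-prime p∣mn)

prime∤⇒coprime : ∀ {p n} → Prime p → p ∤ n → Coprime p n
prime∤⇒coprime p-prime p∤n (d∣p , d∣n) with prime⇒irreducible p-prime d∣p
... | inj₁ d≡1 = d≡1
... | inj₂ refl = contradiction d∣n p∤n

linear-congruence-solvable : ∀ {p w} → Prime p → p ∤ w → ∀ q → ∃ λ c → p ∣ q + c * w
linear-congruence-solvable {suc p′} {w} p-prime p∤w q with coprime-Bézout (prime∤⇒coprime p-prime p∤w)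
... | Bézout.+- x y 1+yw≡xp = q * y , divides (q * x) (begin
  q + q * y * w     ≡⟨ factor q y w ⟩
  q * (1 + y * w)   ≡⟨ cong (q *_) 1+yw≡xp ⟩
  q * (x * suc p′)  ≡⟨ *-assoc q x (suc p′) ⟨
  q * x * suc p′    ∎)
  where
  open ≡-Reasoning
  factor : ∀ q y w → q + q * y * w ≡ q * (1 + y * w)
  factor = solve-∀
... | Bézout.-+ x y 1+xp≡yw = q * y * p′ , divides (q + q * p′ * x) (begin
  q + q * y * p′ * w              ≡⟨ regroup q y p′ w ⟩
  q + q * p′ * (y * w)            ≡⟨ cong (λ z → q + q * p′ * z) 1+xp≡yw ⟨
  q + q * p′ * (1 + x * suc p′)   ≡⟨ factor q p′ x ⟩
  (q + q * p′ * x) * suc p′       ∎)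
  where
  open ≡-Reasoning
  regroup : ∀ q y p′ w → q + q * y * p′ * w ≡ q + q * p′ * (y * w)
  regroup = solve-∀
  factor : ∀ q p′ x → q + q * p′ * (1 + x * suc p′) ≡ (q + q * p′ * x) * suc p′
  factor = solve-∀

hensel-step : ∀ {p k a d} → Prime p → p ^ suc k ∣ Φ a d → p ∤ ∂Φ a d →
              ∃ λ a′ → p ^ suc (suc k) ∣ Φ a′ d × p ∤ ∂Φ a′ d
hensel-step {p} {k} {a} {d} p-prime (divides q Φ≡qM) p∤∂Φ
  with linear-congruence-solvable p-prime p∤∂Φ q
... | c , p∣q+c∂Φ = a + M * c , pM∣Φ′ , p∤∂Φ′
  where
  open ≡-Reasoning
  M : ℕ
  M = p ^ suc k

  p∣M : p ∣ M
  p∣M = m∣m*n (p ^ k)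

  regroup : ∀ q c w M → q * M + M * (c * (w + 3 * M * c)) ≡ (q + c * w) * M + M * M * (3 * c * c)
  regroup = solve-∀

  Φ′≡ : Φ (a + M * c) d ≡ (q + c * ∂Φ a d) * M + M * M * (3 * c * c)
  Φ′≡ = begin
    Φ (a + M * c) d                            ≡⟨ Φ-shift a d M c ⟩
    Φ a d + M * (c * (∂Φ a d + 3 * M * c))     ≡⟨ cong (_+ M * (c * (∂Φ a d + 3 * M * c))) Φ≡qM ⟩
    q * M + M * (c * (∂Φ a d + 3 * M * c))     ≡⟨ regroup q c (∂Φ a d) M ⟩
    (q + c * ∂Φ a d) * M + M * M * (3 * c * c) ∎

  pM∣Φ′ : p * M ∣ Φ (a + M * c) d
  pM∣Φ′ = subst (p * M ∣_) (sym Φ′≡)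
            (∣m∣n⇒∣m+n (*-monoˡ-∣ M p∣q+c∂Φ) (∣m⇒∣m*n (3 * c * c) (*-monoˡ-∣ M p∣M)))

  p∤∂Φ′ : p ∤ ∂Φ (a + M * c) d
  p∤∂Φ′ p∣∂Φ′ = p∤∂Φ (∣m+n∣n⇒∣m (subst (p ∣_) (∂Φ-shift a d M c) p∣∂Φ′) (∣m⇒∣m*n (6 * c) p∣M))

hensel-lift : ∀ {p a d} k → Prime p → p ∣ Φ a d → p ∤ ∂Φ a d →
              ∃ λ a′ → p ^ suc k ∣ Φ a′ d × p ∤ ∂Φ a′ d
hensel-lift {p} {a} zero p-prime p∣Φ p∤∂Φ = a , subst (_∣ _) (sym (*-identityʳ p)) p∣Φ , p∤∂Φ
hensel-lift {a = a} {d} (suc k) p-prime p∣Φ p∤∂Φ with hensel-lift {a = a} {d} k p-prime p∣Φ p∤∂Φ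
... | a′ , pᵏ∣Φ , p∤∂Φ′ = hensel-step {k = k} {a′} p-prime pᵏ∣Φ p∤∂Φ′

shifted-representative : ∀ M x → 1 ≤ M → ∃₂ λ y c → 1 ≤ y × y ≤ M × x + M * 1 ≡ y + M * c
shifted-representative M@(suc M′) x _ = suc r , q , s≤s z≤n , m%n<n (x + M′) M , (begin
  x + M * 1              ≡⟨ cong (x +_) (*-identityʳ M) ⟩
  x + suc M′             ≡⟨ +-suc x M′ ⟩
  suc (x + M′)           ≡⟨ cong suc (m≡m%n+[m/n]*n (x + M′) M) ⟩
  suc (r + q * M)        ≡⟨ cong (suc r +_) (*-comm q M) ⟩
  suc r + M * q          ∎)
  where
  open ≡-Reasoning
  r q : ℕ
  r = (x + M′) % M
  q = (x + M′) / M

Φ-root-representative : ∀ {M a} d → 1 ≤ M → M ∣ Φ a d → ∃ λ a′ → 1 ≤ a′ × a′ ≤ M × M ∣ Φ a′ d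
Φ-root-representative {M} {a} d 1≤M M∣Φ with shifted-representative M a 1≤M
... | y , c , 1≤y , y≤M , a+M≡y+Mc = y , 1≤y , y≤M , ∣m+d*n⇒∣m _ M∣Φ[y+Mc]
  where
  M∣Φ[y+Mc] : M ∣ Φ y d + M * (c * (∂Φ y d + 3 * M * c))
  M∣Φ[y+Mc] = subst (M ∣_) (trans (cong (λ z → Φ z d) a+M≡y+Mc) (Φ-shift y d M c))
                (subst (M ∣_) (sym (Φ-shift a d M 1)) (∣m⇒∣m+d*n _ M∣Φ))

%≡%⇒∣+pred* : ∀ {q} x y → x % suc q ≡ y % suc q → suc q ∣ x + q * y
%≡%⇒∣+pred* {q} x y x%p≡y%p = divides (y % p + x / p + q * (y / p)) (begin
  x + q * y                                    ≡⟨ cong₂ (λ u v → u + q * v) (m≡m%n+[m/n]*n x p) (m≡m%n+[m/n]*n y p) ⟩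
  x % p + x / p * p + q * (y % p + y / p * p)   ≡⟨ cong (λ r → r + x / p * p + q * (y % p + y / p * p)) x%p≡y%p ⟩
  y % p + x / p * p + q * (y % p + y / p * p)   ≡⟨ factor (y % p) (x / p) (y / p) q ⟩
  (y % p + x / p + q * (y / p)) * p            ∎)
  where
  open ≡-Reasoning
  p : ℕ
  p = suc q
  factor : ∀ r X Y q → r + X * suc q + q * (r + Y * suc q) ≡ (r + X + q * Y) * suc q
  factor = solve-∀

square-%-injective : ∀ {q} → Prime (suc q) → ∀ c k {x y} → x ≤ y →
                     suc q ∤ c → suc q ∤ y ∸ x → suc q ∤ x + y →
                     (c * (x * x) + k) % suc q ≢ (c * (y * y) + k) % suc q
square-%-injective {q} p-prime c k {x} x≤y p∤c p∤y∸x p∤x+y with m≤n⇒∃[o]m+o≡n x≤y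
... | e , refl = λ residues≡ →
  ∤∧∤⇒∤* p-prime p∤c (∤∧∤⇒∤* p-prime p∤e p∤x+y)
    (∣m+d*n⇒∣m _ (subst (suc q ∣_) (difference c k x e q)
      (%≡%⇒∣+pred* (c * ((x + e) * (x + e)) + k) (c * (x * x) + k) (sym residues≡))))
  where
  p∤e : suc q ∤ e
  p∤e = p∤y∸x ∘ subst (suc q ∣_) (sym (m+n∸m≡n x e))
  difference : ∀ c k x e q → c * ((x + e) * (x + e)) + k + q * (c * (x * x) + k)
                           ≡ c * (e * (x + (x + e))) + suc q * (c * (x * x) + k)
  difference = solve-∀

pigeonhole-% : ∀ {p h} .{{_ : NonZero p}} → p < suc h + suc h → (f g : ℕ → ℕ) →
               (∀ {u v} → u < v → v ≤ h → f u % p ≢ f v % p) →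
               (∀ {u v} → u < v → v ≤ h → g u % p ≢ g v % p) →
               ∃₂ λ u v → u ≤ h × v ≤ h × f u % p ≡ g v % p
pigeonhole-% {p} {h} p<2[h+1] f g f-injective g-injective =
  from-collision (pigeonhole p<2[h+1] (residue ∘ splitAt (suc h)))
  where
  value : Fin (suc h) ⊎ Fin (suc h) → ℕ
  value = [ f ∘ toℕ , g ∘ toℕ ]′

  residue : Fin (suc h) ⊎ Fin (suc h) → Fin p
  residue x = fromℕ< (m%n<n (value x) p)

  residue-injective : ∀ x y → residue x ≡ residue y → value x % p ≡ value y % p
  residue-injective _ _ eq = trans (sym (toℕ-fromℕ< _)) (trans (cong toℕ eq) (toℕ-fromℕ< _))

  splitAt-injective : ∀ {i j} → splitAt (suc h) i ≡ splitAt (suc h) j → i ≡ j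
  splitAt-injective {i} {j} eq = begin
    i                                  ≡⟨ join-splitAt (suc h) (suc h) i ⟨
    join (suc h) (suc h) (splitAt (suc h) i) ≡⟨ cong (join (suc h) (suc h)) eq ⟩
    join (suc h) (suc h) (splitAt (suc h) j) ≡⟨ join-splitAt (suc h) (suc h) j ⟩
    j                                  ∎
    where open ≡-Reasoning

  distinct : (F : ℕ → ℕ) → (∀ {u v} → u < v → v ≤ h → F u % p ≢ F v % p) →
             ∀ u v → u ≢ v → F (toℕ u) % p ≢ F (toℕ v) % p
  distinct F F-injective u v u≢v with <-cmp (toℕ u) (toℕ v)
  ... | tri< u<v _ _ = F-injective u<v (toℕ≤pred[n] v)
  ... | tri≈ _ u≡v _ = contradiction (toℕ-injective u≡v) u≢v
  ... | tri> _ _ v<u = F-injective v<u (toℕ≤pred[n] u) ∘ sym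

  collide : ∀ x y → x ≢ y → value x % p ≡ value y % p → ∃₂ λ u v → u ≤ h × v ≤ h × f u % p ≡ g v % p
  collide (inj₁ u) (inj₁ v) x≢y eq = contradiction eq (distinct f f-injective u v (x≢y ∘ cong inj₁))
  collide (inj₂ u) (inj₂ v) x≢y eq = contradiction eq (distinct g g-injective u v (x≢y ∘ cong inj₂))
  collide (inj₁ u) (inj₂ v) _ eq = toℕ u , toℕ v , toℕ≤pred[n] u , toℕ≤pred[n] v , eq
  collide (inj₂ v) (inj₁ u) _ eq = toℕ u , toℕ v , toℕ≤pred[n] u , toℕ≤pred[n] v , sym eq

  from-collision : (∃₂ λ i j → i Fin.< j × residue (splitAt (suc h) i) ≡ residue (splitAt (suc h) j)) →
                   ∃₂ λ u v → u ≤ h × v ≤ h × f u % p ≡ g v % p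
  from-collision (i , j , i<j , residues≡) =
    collide (splitAt (suc h) i) (splitAt (suc h) j) (<⇒≢ i<j ∘ cong toℕ ∘ splitAt-injective)
      (residue-injective (splitAt (suc h) i) (splitAt (suc h) j) residues≡)

∣n*n+1⇒∤n : ∀ {p n} → 2 ≤ p → p ∣ n * n + 1 → p ∤ n
∣n*n+1⇒∤n {p} {n} 2≤p p∣n²+1 p∣n = <⇒≢ 2≤p (sym (∣1⇒≡1 (∣m+n∣m⇒∣n p∣n²+1 (∣m⇒∣m*n n p∣n))))

HenselSeed : ℕ → ℕ → Set
HenselSeed p δ = ∃₂ λ a t → 1 ≤ t × t ≤ p × p ∣ Φ a (δ * t) × p ∤ ∂Φ a (δ * t)

module OddPrime {h : ℕ} (p-prime : Prime (suc (h + h))) (5≤p : 5 ≤ suc (h + h)) where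

  private
    p q : ℕ
    p = suc (h + h)
    q = h + h

  0<n<5⇒p∤n : ∀ {n} → 0 < n → n < 5 → p ∤ n
  0<n<5⇒p∤n 0<n n<5 = 0<n<p⇒∤ 0<n (<-≤-trans n<5 5≤p)

  p∤2 : p ∤ 2
  p∤2 = 0<n<5⇒p∤n (s≤s z≤n) (s≤s (s≤s (s≤s z≤n)))

  p∤3 : p ∤ 3
  p∤3 = 0<n<5⇒p∤n (s≤s z≤n) (s≤s (s≤s (s≤s (s≤s z≤n))))

  p∤4 : p ∤ 4
  p∤4 = 0<n<5⇒p∤n (s≤s z≤n) (s≤s (s≤s (s≤s (s≤s (s≤s z≤n)))))

  p<2[h+1] : p < suc h + suc h
  p<2[h+1] = s≤s (≤-reflexive (sym (+-suc h h)))

  ≤h⇒<p : ∀ {n} → n ≤ h → n < p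
  ≤h⇒<p n≤h = s≤s (≤-trans n≤h (m≤m+n h h))

  ∣m*n⇒∣n : ∀ {m} n → p ∤ m → p ∣ m * n → p ∣ n
  ∣m*n⇒∣n n p∤m = coprime-divisor (prime∤⇒coprime p-prime p∤m)

  p∤q : p ∤ q
  p∤q = 0<n<p⇒∤ (≤-trans (s≤s z≤n) (s≤s⁻¹ 5≤p)) (n<1+n q)

  odd : ℕ → ℕ
  odd v = suc (2 * v)

  odd≤p : ∀ {v} → v ≤ h → odd v ≤ p
  odd≤p {v} v≤h = s≤s (+-mono-≤ v≤h (subst (_≤ h) (sym (+-identityʳ v)) v≤h))

  -- Both families have the shape c · x² + k of square-%-injective.
  thrice-square : ℕ → ℕ
  thrice-square u = 3 * (u * u) + 0

  -- ≡ −((δ · odd v)² + 4) (mod p), as q ≡ −1.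
  negated-norm : ℕ → ℕ → ℕ
  negated-norm δ v = q * (δ * δ) * (odd v * odd v) + q * 4

  thrice-square-injective : ∀ {u v} → u < v → v ≤ h → thrice-square u % p ≢ thrice-square v % p
  thrice-square-injective {u} {v} u<v v≤h =
    square-%-injective p-prime 3 0 (<⇒≤ u<v) p∤3
      (0<n<p⇒∤ (m<n⇒0<n∸m u<v) (≤h⇒<p (≤-trans (m∸n≤m v u) v≤h)))
      (0<n<p⇒∤ (<-≤-trans (≤-<-trans z≤n u<v) (m≤n+m v u)) (s≤s (+-mono-≤ (≤-trans (<⇒≤ u<v) v≤h) v≤h)))

  negated-norm-injective : ∀ {δ} → p ∤ δ → ∀ {u v} → u < v → v ≤ h → negated-norm δ u % p ≢ negated-norm δ v % p
  negated-norm-injective {δ} p∤δ {u} {v} u<v v≤h =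
    square-%-injective p-prime (q * (δ * δ)) (q * 4) (s≤s (*-monoʳ-≤ 2 (<⇒≤ u<v)))
      (∤∧∤⇒∤* p-prime p∤q (∤∧∤⇒∤* p-prime p∤δ p∤δ))
      (subst (p ∤_) (*-distribˡ-∸ 2 v u)
        (∤∧∤⇒∤* p-prime p∤2 (0<n<p⇒∤ (m<n⇒0<n∸m u<v) (≤h⇒<p (≤-trans (m∸n≤m v u) v≤h)))))
      (subst (p ∤_) (sym (odd+odd u v))
        (∤∧∤⇒∤* p-prime p∤2 (0<n<p⇒∤ (s≤s z≤n) (s≤s (+-mono-≤ (≤-trans u<v v≤h) v≤h)))))
    where
    odd+odd : ∀ u v → suc (2 * u) + suc (2 * v) ≡ 2 * suc (u + v)
    odd+odd = solve-∀

  collision⇒p∣norm : ∀ {δ u v} → thrice-square u % p ≡ negated-norm δ v % p →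
                     p ∣ 3 * (u * u) + (δ * odd v) * (δ * odd v) + 4
  collision⇒p∣norm {δ} {u} {v} residues≡ =
    ∣m*n⇒∣n _ p∤q (subst (p ∣_) (factor q δ (odd v) u)
      (%≡%⇒∣+pred* (negated-norm δ v) (thrice-square u) (sym residues≡)))
    where
    factor : ∀ q δ w u → q * (δ * δ) * (w * w) + q * 4 + q * (3 * (u * u) + 0)
                       ≡ q * (3 * (u * u) + (δ * w) * (δ * w) + 4)
    factor = solve-∀

  Φ-root-from-norm : ∀ {x d} → p ∤ x → p ∣ 3 * (x * x) + d * d + 4 → ∃ λ a → p ∣ Φ a d × p ∤ ∂Φ a d
  Φ-root-from-norm {x} {d} p∤x p∣norm = a , p∣Φ , p∤∂Φ
    where
    -- 2a + d ≡ x (mod p), as 2 (h + 1) = p + 1.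
    a K : ℕ
    a = suc h * (x + q * d)
    K = x + q * d + d

    four-Φ : 4 * Φ a d ≡ 3 * (x * x) + d * d + 4 + p * (3 * K * (2 * x + p * K))
    four-Φ = identity h x d
      where
      identity : ∀ h x d →
        4 * (3 * (suc h * (x + (h + h) * d)) * (suc h * (x + (h + h) * d))
             + 3 * (suc h * (x + (h + h) * d)) * d + d * d + 1)
        ≡ 3 * (x * x) + d * d + 4
          + suc (h + h) * (3 * (x + (h + h) * d + d) * (2 * x + suc (h + h) * (x + (h + h) * d + d)))
      identity = solve-∀

    ∂Φ≡ : ∂Φ a d ≡ 3 * x + p * (3 * K)
    ∂Φ≡ = identity h x d
      where
      identity : ∀ h x d → 3 * (2 * (suc h * (x + (h + h) * d)) + d)
                         ≡ 3 * x + suc (h + h) * (3 * (x + (h + h) * d + d))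
      identity = solve-∀

    p∣Φ : p ∣ Φ a d
    p∣Φ = ∣m*n⇒∣n (Φ a d) p∤4 (subst (p ∣_) (sym four-Φ) (∣m⇒∣m+d*n _ p∣norm))

    p∤∂Φ : p ∤ ∂Φ a d
    p∤∂Φ p∣∂Φ = ∤∧∤⇒∤* p-prime p∤3 p∤x (∣m+d*n⇒∣m _ (subst (p ∣_) ∂Φ≡ p∣∂Φ))

  seed-at-zero : ∀ {δ} v → v ≤ h → p ∣ (δ * odd v) * (δ * odd v) + 4 → HenselSeed p δ
  seed-at-zero {δ} v v≤h p∣norm = 0 , t , s≤s z≤n , s≤s (+-monoʳ-≤ h v≤h) , p∣Φ , p∤∂Φ
    where
    -- 2t ≡ odd v (mod p).
    t : ℕ
    t = suc h + v

    four-Φ : 4 * Φ 0 (δ * t) ≡ (δ * odd v) * (δ * odd v) + 4 + p * (δ * δ * (2 * odd v + p))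
    four-Φ = identity h v δ
      where
      identity : ∀ h v δ → 4 * ((δ * (suc h + v)) * (δ * (suc h + v)) + 1)
                         ≡ (δ * suc (2 * v)) * (δ * suc (2 * v)) + 4
                           + suc (h + h) * (δ * δ * (2 * suc (2 * v) + suc (h + h)))
      identity = solve-∀

    p∣Φ : p ∣ Φ 0 (δ * t)
    p∣Φ = ∣m*n⇒∣n (Φ 0 (δ * t)) p∤4 (subst (p ∣_) (sym four-Φ) (∣m⇒∣m+d*n _ p∣norm))

    p∤∂Φ : p ∤ ∂Φ 0 (δ * t)
    p∤∂Φ = ∤∧∤⇒∤* p-prime p∤3 (∣n*n+1⇒∤n {n = δ * t} (≤-trans (s≤s (s≤s z≤n)) 5≤p) p∣Φ)

  seed-from-norm : ∀ {δ} u v → u ≤ h → v ≤ h → p ∣ 3 * (u * u) + (δ * odd v) * (δ * odd v) + 4 →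
                   HenselSeed p δ
  seed-from-norm {δ} zero v _ v≤h p∣norm = seed-at-zero {δ} v v≤h p∣norm
  seed-from-norm {δ} u@(suc _) v u≤h v≤h p∣norm =
    let a , p∣Φ , p∤∂Φ = Φ-root-from-norm {u} {δ * odd v} (0<n<p⇒∤ (s≤s z≤n) (≤h⇒<p u≤h)) p∣norm
    in a , odd v , s≤s z≤n , odd≤p v≤h , p∣Φ , p∤∂Φ

  hensel-seed : ∀ {δ} → p ∤ δ → HenselSeed p δ
  hensel-seed {δ} p∤δ =
    let u , v , u≤h , v≤h , residues≡ = pigeonhole-% p<2[h+1] thrice-square (negated-norm δ)
                                          thrice-square-injective (negated-norm-injective p∤δ)
    in seed-from-norm {δ} u v u≤h v≤h (collision⇒p∣norm {δ} {u} {v} residues≡)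

prime≥3⇒odd : ∀ {p} → Prime p → 3 ≤ p → ∃ λ h → p ≡ suc (h + h)
prime≥3⇒odd {p} p-prime 3≤p with p % 2 | m≡m%n+[m/n]*n p 2 | m%n<n p 2
... | 0 | p≡[p/2]*2 | _ =
  contradiction (prime⇒irreducible p-prime (divides (p / 2) p≡[p/2]*2)) [ (λ ()) , <⇒≢ 3≤p ]′
... | 1 | p≡1+[p/2]*2 | _ = p / 2 , trans p≡1+[p/2]*2 (cong suc (n*2≡n+n (p / 2)))
  where
  n*2≡n+n : ∀ n → n * 2 ≡ n + n
  n*2≡n+n = solve-∀
... | suc (suc _) | _ | s≤s (s≤s ())

hensel-seed : ∀ {p δ} → Prime p → 5 ≤ p → p ∤ δ → HenselSeed p δ
hensel-seed {δ = δ} p-prime 5≤p with prime≥3⇒odd p-prime (≤-trans (s≤s (s≤s (s≤s z≤n))) 5≤p)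
... | h , refl = OddPrime.hensel-seed {h} p-prime 5≤p {δ}

CubicCollision : ℕ → ℕ → Set
CubicCollision n m = ∃[ a ] ∃[ b ] (1 ≤ a × a < b × b ≤ n × (b ^ 3 + b) ≡ (a ^ 3 + a) [mod m ])

LargeEnough : ℕ → ℕ → Set
LargeEnough δ Q = 3 * (δ + Q) ≤ δ * Q

∣∸⇒≡[mod] : ∀ {m x y} → y ≤ x → m ∣ x ∸ y → x ≡ y [mod m ]
∣∸⇒≡[mod] {m} {x} {y} y≤x = subst (m ∣_) (sym (cong ℤ.∣_∣ (trans (m-n≡m⊖n x y) (⊖-≥ y≤x))))

collision-from-seed : ∀ {n δ p} s → Prime p → p ∤ δ → HenselSeed p δ →
                      LargeEnough δ (p ^ s) → δ * p ^ suc s < 3 * n →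
                      CubicCollision n (δ * p ^ suc s)
collision-from-seed {n} {δ} {p} s p-prime p∤δ (a₀ , t , 1≤t , t≤p , p∣Φ₀ , p∤∂Φ₀) large m<3n =
  a , a + d , 1≤a , m<m+n a 1≤d , b≤n , congruent
  where
  open ≤-Reasoning
  M d : ℕ
  M = p ^ suc s
  d = δ * t

  lifted : ∃ λ a₁ → M ∣ Φ a₁ d × p ∤ ∂Φ a₁ d
  lifted = hensel-lift {a = a₀} {d} s p-prime p∣Φ₀ p∤∂Φ₀

  reduced : ∃ λ a → 1 ≤ a × a ≤ M × M ∣ Φ a d
  reduced = Φ-root-representative {M} {proj₁ lifted} d (m^n>0 p {{prime⇒nonZero p-prime}} (suc s))
              (proj₁ (proj₂ lifted))

  a : ℕ
  a = proj₁ reduced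

  1≤a : 1 ≤ a
  1≤a = proj₁ (proj₂ reduced)

  a≤M : a ≤ M
  a≤M = proj₁ (proj₂ (proj₂ reduced))

  M∣Φ : M ∣ Φ a d
  M∣Φ = proj₂ (proj₂ (proj₂ reduced))

  1≤δ : 1 ≤ δ
  1≤δ = n≢0⇒n>0 λ { refl → p∤δ (p ∣0) }

  1≤d : 1 ≤ d
  1≤d = *-mono-≤ 1≤δ 1≤t

  3b≤m : 3 * (a + d) ≤ δ * M
  3b≤m = begin
    3 * (a + δ * t)           ≤⟨ *-monoʳ-≤ 3 (+-mono-≤ a≤M (*-monoʳ-≤ δ t≤p)) ⟩
    3 * (p * p ^ s + δ * p)   ≡⟨ regroup p (p ^ s) δ ⟩
    p * (3 * (δ + p ^ s))     ≤⟨ *-monoʳ-≤ p large ⟩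
    p * (δ * p ^ s)           ≡⟨ swap p δ (p ^ s) ⟩
    δ * M                     ∎
    where
    regroup : ∀ p Q δ → 3 * (p * Q + δ * p) ≡ p * (3 * (δ + Q))
    regroup = solve-∀
    swap : ∀ p δ Q → p * (δ * Q) ≡ δ * (p * Q)
    swap = solve-∀

  b≤n : a + d ≤ n
  b≤n = *-cancelˡ-≤ 3 (≤-trans 3b≤m (<⇒≤ m<3n))

  m∣dΦ : δ * M ∣ d * Φ a d
  m∣dΦ = subst (δ * M ∣_) (sym (*-assoc δ t (Φ a d))) (*-monoʳ-∣ δ (∣n⇒∣m*n t M∣Φ))

  congruent : ((a + d) ^ 3 + (a + d)) ≡ (a ^ 3 + a) [mod δ * M ]
  congruent rewrite x³+x-shift a d =
    ∣∸⇒≡[mod] {δ * M} {a ^ 3 + a + d * Φ a d} {a ^ 3 + a} (m≤m+n (a ^ 3 + a) (d * Φ a d))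
      (subst (δ * M ∣_) (sym (m+n∸m≡n (a ^ 3 + a) (d * Φ a d))) m∣dΦ)

large-enough-if-δ≥4∧Q≥12 : ∀ {δ Q} → 4 ≤ δ → 12 ≤ Q → LargeEnough δ Q
large-enough-if-δ≥4∧Q≥12 4≤δ 12≤Q =
  let x , 4+x≡δ = m≤n⇒∃[o]m+o≡n 4≤δ ; y , 12+y≡Q = m≤n⇒∃[o]m+o≡n 12≤Q in
  subst₂ LargeEnough 4+x≡δ 12+y≡Q
    (subst (3 * ((4 + x) + (12 + y)) ≤_) (sym (expand x y))
      (m≤m+n (3 * ((4 + x) + (12 + y))) (9 * x + y + x * y)))
  where
  expand : ∀ x y → (4 + x) * (12 + y) ≡ 3 * ((4 + x) + (12 + y)) + (9 * x + y + x * y)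
  expand = solve-∀

large-enough-if-δ≥8∧Q≥5 : ∀ {δ Q} → 8 ≤ δ → 5 ≤ Q → LargeEnough δ Q
large-enough-if-δ≥8∧Q≥5 8≤δ 5≤Q =
  let x , 8+x≡δ = m≤n⇒∃[o]m+o≡n 8≤δ ; y , 5+y≡Q = m≤n⇒∃[o]m+o≡n 5≤Q in
  subst₂ LargeEnough 8+x≡δ 5+y≡Q
    (subst (3 * ((8 + x) + (5 + y)) ≤_) (sym (expand x y))
      (m≤m+n (3 * ((8 + x) + (5 + y))) (1 + 2 * x + 5 * y + x * y)))
  where
  expand : ∀ x y → (8 + x) * (5 + y) ≡ 3 * ((8 + x) + (5 + y)) + (1 + 2 * x + 5 * y + x * y)
  expand = solve-∀

p≤p^[1+s] : ∀ {p} s → 1 ≤ p → p ≤ p ^ suc s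
p≤p^[1+s] {p} s 1≤p = subst (_≤ p ^ suc s) (*-identityʳ p) (*-monoʳ-≤ p (m^n>0 p {{>-nonZero 1≤p}} s))

small-parameters : ∀ {δ p} s → 4 ≤ δ → 5 ≤ p → ¬ LargeEnough δ (p ^ suc s) →
                   δ < 8 × p < 12 × s ≡ 0
small-parameters {δ} {p} s 4≤δ 5≤p small with δ <? 8 | p ^ suc s <? 12
... | no δ≮8 | _ = contradiction (large-enough-if-δ≥8∧Q≥5 (≮⇒≥ δ≮8) (≤-trans 5≤p p≤Q)) small
  where
  p≤Q : p ≤ p ^ suc s
  p≤Q = p≤p^[1+s] s (≤-trans (s≤s z≤n) 5≤p)
... | yes _ | no Q≮12 = contradiction (large-enough-if-δ≥4∧Q≥12 4≤δ (≮⇒≥ Q≮12)) small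
... | yes δ<8 | yes Q<12 = δ<8 , ≤-<-trans (p≤p^[1+s] s (≤-trans (s≤s z≤n) 5≤p)) Q<12 , s≡0 s Q<12
  where
  s≡0 : ∀ s → p ^ suc s < 12 → s ≡ 0
  s≡0 zero _ = refl
  s≡0 (suc s) Q<12 = contradiction (*-mono-≤ 5≤p (≤-trans 5≤p (p≤p^[1+s] s (≤-trans (s≤s z≤n) 5≤p))))
                                   (<⇒≱ (<-trans Q<12 (≤ᵇ⇒≤ 13 25 _)))

IsSmallWitness : ℕ → ℕ × ℕ → Set
IsSmallWitness m (a , b) =
  1 ≤ a × a < b × 3 * b ≤ suc m × a ^ 3 + a ≤ b ^ 3 + b × m ∣ (b ^ 3 + b) ∸ (a ^ 3 + a)

is-small-witness? : ∀ m w → Dec (IsSmallWitness m w)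
is-small-witness? m (a , b) =
  1 ≤? a ×-dec a <? b ×-dec 3 * b ≤? suc m ×-dec a ^ 3 + a ≤? b ^ 3 + b ×-dec m ∣? (b ^ 3 + b) ∸ (a ^ 3 + a)

small-collision : ∀ {n m} w → IsSmallWitness m w → m < 3 * n → CubicCollision n m
small-collision (a , b) (1≤a , a<b , 3b≤1+m , Fa≤Fb , m∣Fb∸Fa) m<3n =
  a , b , 1≤a , a<b , *-cancelˡ-≤ 3 (≤-trans 3b≤1+m m<3n) , ∣∸⇒≡[mod] Fa≤Fb m∣Fb∸Fa

-- The pairs (δ , p) that small-parameters leaves open; the witnesses are checked by small-cases.
small-witness : ℕ → ℕ → ℕ × ℕ
small-witness 4 5  = 3 , 5
small-witness 4 7  = 3 , 10
small-witness 4 11 = 1 , 15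
small-witness 5 7  = 3 , 8
small-witness 6 5  = 10 , 13
small-witness 7 5  = 3 , 17
small-witness _ _  = 0 , 0

SmallCase : ℕ → ℕ → Set
SmallCase δ p = 4 ≤ δ → Prime p → 5 ≤ p → p ∤ δ → ¬ LargeEnough δ (p ^ 1) →
                IsSmallWitness (δ * p ^ 2) (small-witness δ p)

small-case? : ∀ δ p → Dec (SmallCase δ p)
small-case? δ p = 4 ≤? δ →-dec prime? p →-dec 5 ≤? p →-dec ¬? (p ∣? δ) →-dec ¬? (3 * (δ + p ^ 1) ≤? δ * p ^ 1) →-dec
                  is-small-witness? (δ * p ^ 2) (small-witness δ p)

small-cases : ∀ {δ} → δ < 8 → ∀ {p} → p < 12 → SmallCase δ p
small-cases = toWitness {a? = allUpTo? (λ δ → allUpTo? (small-case? δ) 12) 8} _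

cubic-collision : ∀ {n δ p} s → Prime p → 5 ≤ p → 4 ≤ δ → p ∤ δ →
                  δ * p ^ suc (suc s) < 3 * n → CubicCollision n (δ * p ^ suc (suc s))
cubic-collision {δ = δ} {p} s p-prime 5≤p 4≤δ p∤δ m<3n with 3 * (δ + p ^ suc s) ≤? δ * p ^ suc s
... | yes large = collision-from-seed (suc s) p-prime p∤δ (hensel-seed p-prime 5≤p p∤δ) large m<3n
... | no small with small-parameters s 4≤δ 5≤p small
...   | δ<8 , p<12 , refl =
  small-collision (small-witness δ p) (small-cases δ<8 p<12 4≤δ p-prime 5≤p p∤δ small) m<3n

lemma4p1 : ∀ (n k m δ p r : ℕ) → 1 ≤ n → IsCeilLog3 n k → n ≤ m → m < 3 ^ k → 3 ^ k < 3 * n →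
    m ≡ δ * p ^ r → 4 ≤ δ → Prime p → 5 ≤ p → 2 ≤ r → ¬ (p ∣ δ) →
    ∃[ a ] ∃[ b ] (1 ≤ a × a < b × b ≤ n × (b ^ 3 + b) ≡ (a ^ 3 + a) [mod m ])
lemma4p1 n k m δ p (suc (suc s)) _ _ _ m<3ᵏ 3ᵏ<3n refl 4≤δ p-prime 5≤p (s≤s (s≤s _)) p∤δ =
  cubic-collision s p-prime 5≤p 4≤δ p∤δ (<-trans m<3ᵏ 3ᵏ<3n)
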